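{- Let $k\ge0$ be an integer. Then $P^{[k]}_{j,i}=0$ if $j\le k$ or $i\le k$, and $P^{[0]}_{j,1}=1$ for $j>0$. Moreover, for integers $i\ge2$ and $j\ge1$, $$P^{[0]}_{j,i}=(a_j+b_1)\,\overline{P}^{[0]}_{j,i-1}+\overline{P}^{[0]}_{j-1,i-1}+\Bigl[P^{[0]}_{j-1,i}-(a_{j-1}+b_1)\,\overline{P}^{[0]}_{j-1,i-1}\Bigr],$$ and for $k\ge1$, $j>k$, $i>k$, $$P^{[k]}_{j,i}=(a_j+b_1)\,\overline{P}^{[k]}_{j,i-1}+\overline{P}^{[k-1]}_{j-1,i-1}.$$
   Context: $a_1,a_2,\dots$ and $b_1,b_2,\dots$ are indeterminates. For a partition $\lambda$, an index $j$ is critical if $2\le j\le\ell(\lambda)$ and $\lambda_j=\lambda_{j-1}$, and the weight is $w(\lambda)=\prod_{j\ \mathrm{critical}}(a_{\lambda_j}+b_{j-1})$. For integers $j,i\ge0$ and $k\ge0$, $P^{[k]}_{j,i}$ is the sum of $w(\lambda)$ over all partitions $\lambda$ of length $i$ with first part $\lambda_1=j$ having, for each $l=1,\dots,k$, at least one part equal to $j-l$ (an empty sum is $0$). $\overline{P}^{[k]}_{j,i}$ denotes the result of substituting $b_l\leftarrow b_{l+1}$ for all $l\ge1$ in $P^{[k]}_{j,i}$. -}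

module Defs where

open import Data.Nat using (ℕ; zero; suc; _≡ᵇ_; _≤ᵇ_) renaming (_+_ to _+ℕ_)
open import Data.Bool using (Bool; true; false; _∧_; if_then_else_)
open import Data.List using (List; []; _∷_; map; concatMap; foldr; upTo)
open import Data.Bool.ListAction using (any; all)
open import Algebra.Bundles using (CommutativeRing)

allLists : ℕ → ℕ → List (List ℕ)
allLists zero    m = [] ∷ []
allLists (suc n) m = concatMap (λ x → map (x ∷_) (allLists n m)) (upTo m)

nonIncreasing : List ℕ → Bool
nonIncreasing (x ∷ y ∷ r) = (y ≤ᵇ x) ∧ nonIncreasing (y ∷ r)
nonIncreasing _           = true

isPartition : List ℕ → Bool
isPartition ps = nonIncreasing ps ∧ all (λ x → 1 ≤ᵇ x) ps

firstPartIs : ℕ → List ℕ → Bool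
firstPartIs j []      = false
firstPartIs j (x ∷ _) = x ≡ᵇ j

-- for each l = 1..k there is a part equal to j - l  (i.e. a part x with x + l = j)
hasParts : ℕ → ℕ → List ℕ → Bool
hasParts k j ps = all (λ l → any (λ x → (x +ℕ suc l) ≡ᵇ j) ps) (upTo k)

module _ {c ℓ} (R : CommutativeRing c ℓ) where
  open CommutativeRing R

  -- weightFrom a b p ps : ps is the tail of a partition starting at position p;
  -- a pair (λ_p, λ_{p+1}) with λ_{p+1} = λ_p makes index p+1 critical,
  -- contributing the factor (a_{λ_{p+1}} + b_p).
  weightFrom : (ℕ → Carrier) → (ℕ → Carrier) → ℕ → List ℕ → Carrier
  weightFrom a b p (x ∷ y ∷ r) =
    (if y ≡ᵇ x then a y + b p else 1#) * weightFrom a b (suc p) (y ∷ r)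
  weightFrom a b p _ = 1#

  -- w(λ) = ∏_{j critical} (a_{λ_j} + b_{j-1})
  weight : (ℕ → Carrier) → (ℕ → Carrier) → List ℕ → Carrier
  weight a b ps = weightFrom a b 1 ps

  -- Every such λ has entries in
  -- {1..j}, so it occurs (exactly once) among allLists i (suc j).
  P : (ℕ → Carrier) → (ℕ → Carrier) → ℕ → ℕ → ℕ → Carrier
  P a b k j i = foldr _+_ 0#
    (map (λ ps → if isPartition ps ∧ firstPartIs j ps ∧ hasParts k j ps
                   then weight a b ps else 0#)
         (allLists i (suc j)))

  Pbar : (ℕ → Carrier) → (ℕ → Carrier) → ℕ → ℕ → ℕ → Carrier
  Pbar a b = P a (λ l → b (suc l))

module Submission where

-- A partition counted by P^{[k]}_{j,n+2} is a list j ∷ y ∷ qs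
-- with y ≤ j.  Removing the first part j leaves the partition y ∷ qs; its
-- critical indices move down by one, so its weight is the weight with
-- b_l ← b_{l+1}, times a_j + b_1 exactly when y = j (index 2 is critical).
-- Summing over y gives the splitting
--   P^{[k]}_{j,n+2} = (a_j + b_1) P̄^{[k]}_{j,n+1} + Σ_{y<j} T_y ,
-- where T_y collects the shifted weights of the tails with second part y.
-- For k = 0 each T_y equals P̄^{[0]}_{y,n+1}, and the k = 0 recurrence of
-- the theorem is the difference of the splittings for j and j - 1.  For
-- k ≥ 1 a part j - 1 must occur, so only T_{j-1} survives, and it equals
-- P̄^{[k-1]}_{j-1,n+1}.  The vanishing for j ≤ k or i ≤ k then follows from
-- the k ≥ 1 recurrence by induction on the length i.

open import Defs
open import Data.Nat using (ℕ; zero; suc; _≤_; _<_; _∸_; _≡ᵇ_; _≤ᵇ_; z≤n; s≤s; _≤′_; ≤′-refl; ≤′-step)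
  renaming (_+_ to _+ℕ_)
open import Data.Nat.Properties
  using (≡ᵇ⇒≡; ≤ᵇ⇒≤; ≤⇒≤ᵇ; ≤-trans; ≤-<-trans; ≤-pred; <⇒≤; <⇒≢; ≤⇒≯; ≤⇒≤′; ≤′⇒≤;
         n<1+n; n≤1+n; m<n⇒m<1+n; m+1+n≢m; suc-injective)
  renaming (+-comm to ℕ-+-comm; +-suc to ℕ-+-suc)
open import Data.Bool using (Bool; true; false; _∧_; _∨_; if_then_else_; T)
open import Data.Bool.Properties using (¬-not; ∧-zeroʳ)
open import Data.Bool.ListAction using (and; or; any; all)
open import Data.Unit using (tt)
open import Data.Sum using (_⊎_; inj₁; inj₂) renaming (map to ⊎-map)
open import Data.Product using (_×_; _,_)
open import Data.List using (List; []; _∷_; [_]; map; concatMap; foldr; upTo; applyUpTo; _++_)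
open import Data.List.Properties using (map-∘; map-cong; map-upTo; upTo-∷ʳ)
open import Data.List.Relation.Unary.All as All using (All; []; _∷_)
open import Data.List.Relation.Unary.All.Properties using (All¬⇒¬Any)
open import Data.List.Relation.Unary.Any using (Any; here; there)
open import Data.List.Membership.Propositional using (_∈_)
open import Data.List.Membership.Propositional.Properties using (∈-upTo⁻)
open import Function using (_∘_; id)
open import Relation.Binary.PropositionalEquality as ≡ using (_≡_; _≢_; cong; cong₂)
open import Algebra.Bundles using (CommutativeRing; Semiring)
import Algebra.Properties.Group as GroupProperties

T⇒true : ∀ {t} → T t → t ≡ true
T⇒true {true} _ = ≡.refl

true⇒T : ∀ {t} → t ≡ true → T t
true⇒T ≡.refl = tt

≡ᵇ-refl : ∀ n → (n ≡ᵇ n) ≡ true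
≡ᵇ-refl zero    = ≡.refl
≡ᵇ-refl (suc n) = ≡ᵇ-refl n

≢⇒≡ᵇ-false : ∀ {m n} → m ≢ n → (m ≡ᵇ n) ≡ false
≢⇒≡ᵇ-false {m} {n} m≢n = ¬-not (m≢n ∘ ≡ᵇ⇒≡ m n ∘ true⇒T)

nonIncreasing-bound : ∀ y qs → nonIncreasing (y ∷ qs) ≡ true → All (_≤ y) qs
nonIncreasing-bound y []       _ = []
nonIncreasing-bound y (z ∷ qs) sorted with z ≤ᵇ y in z≤ᵇy
... | true = z≤y ∷ All.map (λ x≤z → ≤-trans x≤z z≤y) (nonIncreasing-bound z qs sorted)
  where
  z≤y : z ≤ y
  z≤y = ≤ᵇ⇒≤ z y (true⇒T z≤ᵇy)

isPartition-unsorted : ∀ y qs → Any (y <_) qs → isPartition (y ∷ qs) ≡ false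
isPartition-unsorted y qs y<x = cong (_∧ all (λ x → 1 ≤ᵇ x) (y ∷ qs)) (¬-not unsorted)
  where
  unsorted : nonIncreasing (y ∷ qs) ≢ true
  unsorted sorted = All¬⇒¬Any (All.map ≤⇒≯ (nonIncreasing-bound y qs sorted)) y<x

isPartition-zero : ∀ qs → isPartition (0 ∷ qs) ≡ false
isPartition-zero qs = ∧-zeroʳ (nonIncreasing (0 ∷ qs))

isPartition-cons : ∀ j y qs → y ≤ j → 1 ≤ j → isPartition (j ∷ y ∷ qs) ≡ isPartition (y ∷ qs)
isPartition-cons j y qs y≤j 1≤j =
  cong₂ _∧_ (cong (_∧ nonIncreasing (y ∷ qs)) (T⇒true (≤⇒≤ᵇ y≤j)))
            (cong (_∧ all (λ x → 1 ≤ᵇ x) (y ∷ qs)) (T⇒true (≤⇒≤ᵇ 1≤j)))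

-- The part j itself is never one of the parts j - l with l ≥ 1.
hasParts-dropTop : ∀ k j qs → hasParts k j (j ∷ qs) ≡ hasParts k j qs
hasParts-dropTop k j qs = cong and (map-cong notTop (upTo k))
  where
  notTop : ∀ l → any (λ x → (x +ℕ suc l) ≡ᵇ j) (j ∷ qs) ≡ any (λ x → (x +ℕ suc l) ≡ᵇ j) qs
  notTop l = cong (_∨ any (λ x → (x +ℕ suc l) ≡ᵇ j) qs) (≢⇒≡ᵇ-false (m+1+n≢m j))

hasParts-shift : ∀ k j qs → hasParts (suc k) (suc j) (j ∷ qs) ≡ hasParts k j (j ∷ qs)
hasParts-shift k j qs = cong₂ _∧_ hasPrevious (begin
    and (map (has (suc j)) (applyUpTo suc k))  ≡⟨ cong (and ∘ map (has (suc j))) (map-upTo suc k) ⟨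
    and (map (has (suc j)) (map suc (upTo k))) ≡⟨ cong and (map-∘ (upTo k)) ⟨
    and (map (has (suc j) ∘ suc) (upTo k))     ≡⟨ cong and (map-cong shifted (upTo k)) ⟩
    and (map (has j) (upTo k))                 ∎)
  where
  open ≡.≡-Reasoning
  has : ℕ → ℕ → Bool
  has j′ l = any (λ x → (x +ℕ suc l) ≡ᵇ j′) (j ∷ qs)
  hasPrevious : has (suc j) 0 ≡ true
  hasPrevious = cong (_∨ any (λ x → (x +ℕ 1) ≡ᵇ suc j) qs) (≡.trans (cong (_≡ᵇ suc j) (ℕ-+-comm j 1)) (≡ᵇ-refl j))
  shifted : ∀ l → has (suc j) (suc l) ≡ has j l
  shifted l = cong or (map-cong (λ x → cong (_≡ᵇ suc j) (ℕ-+-suc x (suc l))) (j ∷ qs))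

noPrevious : ∀ j ps → All (_< j) ps → any (λ x → (x +ℕ 1) ≡ᵇ suc j) ps ≡ false
noPrevious j []       []           = ≡.refl
noPrevious j (x ∷ ps) (x<j ∷ ps<j) = cong₂ _∨_ (≢⇒≡ᵇ-false x+1≢1+j) (noPrevious j ps ps<j)
  where
  x+1≢1+j : x +ℕ 1 ≢ suc j
  x+1≢1+j eq = <⇒≢ x<j (suc-injective (≡.trans (ℕ-+-comm 1 x) eq))

hasParts-missing : ∀ k j ps → All (_< j) ps → hasParts (suc k) (suc j) ps ≡ false
hasParts-missing k j ps ps<j rewrite noPrevious j ps ps<j = ≡.refl

isPartition-missing : ∀ k j y qs → y < j →
  (isPartition (y ∷ qs) ∧ hasParts (suc k) (suc j) (y ∷ qs)) ≡ false
isPartition-missing k j y qs y<j with nonIncreasing (y ∷ qs) in sorted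
... | false = ≡.refl
... | true  = ≡.trans (cong (all (λ x → 1 ≤ᵇ x) (y ∷ qs) ∧_) (hasParts-missing k j (y ∷ qs) below))
                      (∧-zeroʳ (all (λ x → 1 ≤ᵇ x) (y ∷ qs)))
  where
  below : All (_< j) (y ∷ qs)
  below = y<j ∷ All.map (λ x≤y → ≤-<-trans x≤y y<j) (nonIncreasing-bound y qs sorted)

module FiniteSums {c ℓ} (S : Semiring c ℓ) where
  open Semiring S
  open import Relation.Binary.Reasoning.Setoid setoid

  sumOver : {A : Set} → List A → (A → Carrier) → Carrier
  sumOver xs f = foldr _+_ 0# (map f xs)

  sumOver-congᴹ : {A : Set} (xs : List A) {f g : A → Carrier} →
    (∀ {x} → x ∈ xs → f x ≈ g x) → sumOver xs f ≈ sumOver xs g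
  sumOver-congᴹ []       f≈g = refl
  sumOver-congᴹ (x ∷ xs) f≈g = +-cong (f≈g (here ≡.refl)) (sumOver-congᴹ xs (f≈g ∘ there))

  sumOver-cong : {A : Set} (xs : List A) {f g : A → Carrier} →
    (∀ x → f x ≈ g x) → sumOver xs f ≈ sumOver xs g
  sumOver-cong xs f≈g = sumOver-congᴹ xs (λ {x} _ → f≈g x)

  sumOver-zero : {A : Set} (xs : List A) {f : A → Carrier} →
    (∀ {x} → x ∈ xs → f x ≈ 0#) → sumOver xs f ≈ 0#
  sumOver-zero []       f≈0 = refl
  sumOver-zero (x ∷ xs) f≈0 =
    trans (+-cong (f≈0 (here ≡.refl)) (sumOver-zero xs (f≈0 ∘ there))) (+-identityˡ 0#)

  sumOver-scale : {A : Set} (xs : List A) (f : A → Carrier) (x : Carrier) →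
    sumOver xs (λ l → x * f l) ≈ x * sumOver xs f
  sumOver-scale []       f x = sym (zeroʳ x)
  sumOver-scale (y ∷ xs) f x = trans (+-congˡ (sumOver-scale xs f x)) (sym (distribˡ x _ _))

  sumOver-++ : {A : Set} (xs ys : List A) (f : A → Carrier) →
    sumOver (xs ++ ys) f ≈ sumOver xs f + sumOver ys f
  sumOver-++ []       ys f = sym (+-identityˡ _)
  sumOver-++ (x ∷ xs) ys f = trans (+-congˡ (sumOver-++ xs ys f)) (sym (+-assoc _ _ _))

  sumOver-concatMap : {A B : Set} (h : A → List B) (xs : List A) (f : B → Carrier) →
    sumOver (concatMap h xs) f ≈ sumOver xs (λ x → sumOver (h x) f)
  sumOver-concatMap h []       f = refl
  sumOver-concatMap h (x ∷ xs) f =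
    trans (sumOver-++ (h x) (concatMap h xs) f) (+-congˡ (sumOver-concatMap h xs f))

  sumOver-map : {A B : Set} (g : A → B) (xs : List A) (f : B → Carrier) →
    sumOver (map g xs) f ≡ sumOver xs (f ∘ g)
  sumOver-map g xs f = cong (foldr _+_ 0#) (≡.sym (map-∘ xs))

  sumOver-upTo-last : ∀ n (g : ℕ → Carrier) →
    sumOver (upTo (suc n)) g ≈ sumOver (upTo n) g + g n
  sumOver-upTo-last n g = begin
    sumOver (upTo (suc n)) g         ≡⟨ cong (λ xs → sumOver xs g) (upTo-∷ʳ n) ⟨
    sumOver (upTo n ++ [ n ]) g      ≈⟨ sumOver-++ (upTo n) [ n ] g ⟩
    sumOver (upTo n) g + (g n + 0#)  ≈⟨ +-congˡ (+-identityʳ (g n)) ⟩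
    sumOver (upTo n) g + g n         ∎

  sumOver-upTo-truncate : ∀ {g : ℕ → Carrier} {B m} → B ≤′ m →
    (∀ x → B ≤ x → x < m → g x ≈ 0#) → sumOver (upTo m) g ≈ sumOver (upTo B) g
  sumOver-upTo-truncate ≤′-refl _ = refl
  sumOver-upTo-truncate {g} {B} {suc m} (≤′-step B≤′m) vanish = begin
    sumOver (upTo (suc m)) g  ≈⟨ sumOver-upTo-last m g ⟩
    sumOver (upTo m) g + g m  ≈⟨ +-cong (sumOver-upTo-truncate B≤′m vanish′) (vanish m (≤′⇒≤ B≤′m) (n<1+n m)) ⟩
    sumOver (upTo B) g + 0#   ≈⟨ +-identityʳ _ ⟩
    sumOver (upTo B) g        ∎
    where
    vanish′ : ∀ x → B ≤ x → x < m → g x ≈ 0#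
    vanish′ x B≤x x<m = vanish x B≤x (m<n⇒m<1+n x<m)

  sumLists : ℕ → ℕ → (List ℕ → Carrier) → Carrier
  sumLists n m f = sumOver (allLists n m) f

  sumLists-cons : ∀ n m (f : List ℕ → Carrier) →
    sumLists (suc n) m f ≈ sumOver (upTo m) (λ x → sumLists n m (λ l → f (x ∷ l)))
  sumLists-cons n m f = begin
    sumOver (concatMap (λ x → map (x ∷_) (allLists n m)) (upTo m)) f
      ≈⟨ sumOver-concatMap _ (upTo m) f ⟩
    sumOver (upTo m) (λ x → sumOver (map (x ∷_) (allLists n m)) f)
      ≈⟨ sumOver-cong (upTo m) (λ x → reflexive (sumOver-map (x ∷_) (allLists n m) f)) ⟩
    sumOver (upTo m) (λ x → sumLists n m (λ l → f (x ∷ l)))  ∎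

  sumLists-restrict : ∀ n y m {f : List ℕ → Carrier} → suc y ≤ m →
    (∀ l → Any (y <_) l → f l ≈ 0#) → sumLists n m f ≈ sumLists n (suc y) f
  sumLists-restrict zero    y m y<m vanish = refl
  sumLists-restrict (suc n) y m {f} y<m vanish = begin
    sumLists (suc n) m f                                          ≈⟨ sumLists-cons n m f ⟩
    sumOver (upTo m) (λ x → sumLists n m (λ l → f (x ∷ l)))       ≈⟨ sumOver-upTo-truncate (≤⇒≤′ y<m) largeHead ⟩
    sumOver (upTo (suc y)) (λ x → sumLists n m (λ l → f (x ∷ l)))
      ≈⟨ sumOver-cong (upTo (suc y)) (λ x → sumLists-restrict n y m y<m (λ l → vanish (x ∷ l) ∘ there)) ⟩
    sumOver (upTo (suc y)) (λ x → sumLists n (suc y) (λ l → f (x ∷ l)))  ≈⟨ sumLists-cons n (suc y) f ⟨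
    sumLists (suc n) (suc y) f                                    ∎
    where
    largeHead : ∀ x → suc y ≤ x → x < m → sumLists n m (λ l → f (x ∷ l)) ≈ 0#
    largeHead x y<x _ = sumOver-zero (allLists n m) (λ {l} _ → vanish (x ∷ l) (here y<x))

module Recurrences {c ℓ} (R : CommutativeRing c ℓ) (a : ℕ → CommutativeRing.Carrier R) where
  open CommutativeRing R
  open FiniteSums semiring
  open import Relation.Binary.Reasoning.Setoid setoid

  shift : (ℕ → Carrier) → ℕ → Carrier
  shift b l = b (suc l)

  if-false : ∀ {t} (x : Carrier) → t ≡ false → (if t then x else 0#) ≈ 0#
  if-false x ≡.refl = refl

  if-scale : ∀ t (x w : Carrier) → (if t then x * w else 0#) ≈ x * (if t then w else 0#)
  if-scale true  x w = refl
  if-scale false x w = sym (zeroʳ x)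

  term : (ℕ → Carrier) → ℕ → ℕ → List ℕ → Carrier
  term b k j ps = if isPartition ps ∧ hasParts k j ps then weight R a b ps else 0#

  term-unsorted : ∀ b k j y qs → Any (y <_) qs → term b k j (y ∷ qs) ≈ 0#
  term-unsorted b k j y qs y<x =
    if-false _ (cong (_∧ hasParts k j (y ∷ qs)) (isPartition-unsorted y qs y<x))

  term-zeroPart : ∀ b k j qs → term b k j (0 ∷ qs) ≈ 0#
  term-zeroPart b k j qs = if-false _ (cong (_∧ hasParts k j (0 ∷ qs)) (isPartition-zero qs))

  weightFrom-shift : ∀ b p ps → weightFrom R a b (suc p) ps ≡ weightFrom R a (shift b) p ps
  weightFrom-shift b p []          = ≡.refl
  weightFrom-shift b p (x ∷ [])    = ≡.refl
  weightFrom-shift b p (x ∷ y ∷ r) =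
    cong ((if y ≡ᵇ x then a y + b (suc p) else 1#) *_) (weightFrom-shift b (suc p) (y ∷ r))

  -- Factor of index 2 in j ∷ y ∷ qs: a_j + b_1 if y = j, else 1.
  secondFactor : (ℕ → Carrier) → ℕ → ℕ → Carrier
  secondFactor b j y = if y ≡ᵇ j then a y + b 1 else 1#

  term-dropTop : ∀ b k j y qs → y ≤ j → 1 ≤ j →
    term b k j (j ∷ y ∷ qs) ≈ secondFactor b j y * term (shift b) k j (y ∷ qs)
  term-dropTop b k j y qs y≤j 1≤j = begin
    term b k j (j ∷ y ∷ qs)
      ≡⟨ cong₂ (λ t w → if t then w else 0#) sameTest (cong (secondFactor b j y *_) (weightFrom-shift b 1 (y ∷ qs))) ⟩
    (if isPartition (y ∷ qs) ∧ hasParts k j (y ∷ qs) then secondFactor b j y * weight R a (shift b) (y ∷ qs) else 0#)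
      ≈⟨ if-scale _ (secondFactor b j y) _ ⟩
    secondFactor b j y * term (shift b) k j (y ∷ qs)  ∎
    where
    sameTest : (isPartition (j ∷ y ∷ qs) ∧ hasParts k j (j ∷ y ∷ qs))
             ≡ (isPartition (y ∷ qs) ∧ hasParts k j (y ∷ qs))
    sameTest = cong₂ _∧_ (isPartition-cons j y qs y≤j 1≤j) (hasParts-dropTop k j (y ∷ qs))

  P-head : ∀ b k j n → P R a b k j (suc n) ≈ sumLists n (suc j) (λ qs → term b k j (j ∷ qs))
  P-head b k j n = begin
    P R a b k j (suc n)                                                 ≈⟨ sumLists-cons n (suc j) summand ⟩
    sumOver (upTo (suc j)) (λ x → sumLists n (suc j) (summand ∘ (x ∷_))) ≈⟨ sumOver-upTo-last j _ ⟩
    sumOver (upTo j) (λ x → sumLists n (suc j) (summand ∘ (x ∷_))) + sumLists n (suc j) (summand ∘ (j ∷_))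
      ≈⟨ +-cong (sumOver-zero (upTo j) (λ x∈ → sumOver-zero (allLists n (suc j)) (λ {qs} _ → wrongHead (∈-upTo⁻ x∈) qs)))
                (sumOver-cong (allLists n (suc j)) rightHead) ⟩
    0# + sumLists n (suc j) (λ qs → term b k j (j ∷ qs))                  ≈⟨ +-identityˡ _ ⟩
    sumLists n (suc j) (λ qs → term b k j (j ∷ qs))                       ∎
    where
    summand : List ℕ → Carrier
    summand ps = if isPartition ps ∧ firstPartIs j ps ∧ hasParts k j ps then weight R a b ps else 0#
    wrongHead : ∀ {x} → x < j → ∀ qs → summand (x ∷ qs) ≈ 0#
    wrongHead {x} x<j qs = if-false (weight R a b (x ∷ qs))
      (≡.trans (cong (λ t → isPartition (x ∷ qs) ∧ (t ∧ hasParts k j (x ∷ qs))) (≢⇒≡ᵇ-false (<⇒≢ x<j)))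
               (∧-zeroʳ (isPartition (x ∷ qs))))
    rightHead : ∀ qs → summand (j ∷ qs) ≈ term b k j (j ∷ qs)
    rightHead qs = reflexive (cong (λ t → if isPartition (j ∷ qs) ∧ (t ∧ hasParts k j (j ∷ qs))
                                          then weight R a b (j ∷ qs) else 0#) (≡ᵇ-refl j))

  tails : (ℕ → Carrier) → ℕ → ℕ → ℕ → ℕ → Carrier
  tails b k j n y = sumLists n (suc j) (λ qs → term (shift b) k j (y ∷ qs))

  P-split : ∀ b k j n → 1 ≤ j →
    P R a b k j (suc (suc n)) ≈ (a j + b 1) * Pbar R a b k j (suc n) + sumOver (upTo j) (tails b k j n)
  P-split b k j n 1≤j = begin
    P R a b k j (suc (suc n))                               ≈⟨ P-head b k j (suc n) ⟩
    sumLists (suc n) (suc j) (λ qs → term b k j (j ∷ qs))   ≈⟨ sumLists-cons n (suc j) _ ⟩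
    sumOver (upTo (suc j)) (λ y → sumLists n (suc j) (λ qs → term b k j (j ∷ y ∷ qs)))
      ≈⟨ sumOver-congᴹ (upTo (suc j)) (λ y∈ → dropTop (≤-pred (∈-upTo⁻ y∈))) ⟩
    sumOver (upTo (suc j)) weighted                         ≈⟨ sumOver-upTo-last j weighted ⟩
    sumOver (upTo j) weighted + weighted j
      ≈⟨ +-cong (sumOver-congᴹ (upTo j) (λ y∈ → belowTop (∈-upTo⁻ y∈))) (*-cong atTop (sym (P-head (shift b) k j n))) ⟩
    sumOver (upTo j) (tails b k j n) + (a j + b 1) * Pbar R a b k j (suc n)  ≈⟨ +-comm _ _ ⟩
    (a j + b 1) * Pbar R a b k j (suc n) + sumOver (upTo j) (tails b k j n)  ∎
    where
    weighted : ℕ → Carrier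
    weighted y = secondFactor b j y * tails b k j n y
    dropTop : ∀ {y} → y ≤ j → sumLists n (suc j) (λ qs → term b k j (j ∷ y ∷ qs)) ≈ weighted y
    dropTop {y} y≤j = trans (sumOver-cong (allLists n (suc j)) (λ qs → term-dropTop b k j y qs y≤j 1≤j))
                            (sumOver-scale (allLists n (suc j)) _ (secondFactor b j y))
    belowTop : ∀ {y} → y < j → weighted y ≈ tails b k j n y
    belowTop {y} y<j = trans (*-congʳ (reflexive (cong (λ t → if t then a y + b 1 else 1#) (≢⇒≡ᵇ-false (<⇒≢ y<j)))))
                         (*-identityˡ _)
    atTop : secondFactor b j j ≈ a j + b 1
    atTop = reflexive (cong (λ t → if t then a j + b 1 else 1#) (≡ᵇ-refl j))

  tails-restrict : ∀ b k j n y → y ≤ j →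
    tails b k j n y ≈ sumLists n (suc y) (λ qs → term (shift b) k j (y ∷ qs))
  tails-restrict b k j n y y≤j =
    sumLists-restrict n y (suc j) (s≤s y≤j) (term-unsorted (shift b) k j y)

  tails-unconstrained : ∀ b j n y → y ≤ j → tails b 0 j n y ≈ Pbar R a b 0 y (suc n)
  tails-unconstrained b j n y y≤j = trans (tails-restrict b 0 j n y y≤j) (sym (P-head (shift b) 0 y n))

  -- For k ≥ 1 the tails must contain the part j …
  tails-below : ∀ b k j n y → y < j → tails b (suc k) (suc j) n y ≈ 0#
  tails-below b k j n y y<j =
    sumOver-zero (allLists n (suc (suc j))) (λ {qs} _ → if-false _ (isPartition-missing k j y qs y<j))

  tails-top : ∀ b k j n → tails b (suc k) (suc j) n j ≈ Pbar R a b k j (suc n)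
  tails-top b k j n = begin
    tails b (suc k) (suc j) n j                                           ≈⟨ tails-restrict b (suc k) (suc j) n j (n≤1+n j) ⟩
    sumLists n (suc j) (λ qs → term (shift b) (suc k) (suc j) (j ∷ qs))    ≈⟨ sumOver-cong (allLists n (suc j)) shiftParts ⟩
    sumLists n (suc j) (λ qs → term (shift b) k j (j ∷ qs))                ≈⟨ P-head (shift b) k j n ⟨
    Pbar R a b k j (suc n)                                                ∎
    where
    shiftParts : ∀ qs → term (shift b) (suc k) (suc j) (j ∷ qs) ≈ term (shift b) k j (j ∷ qs)
    shiftParts qs = reflexive (cong (λ t → if isPartition (j ∷ qs) ∧ t then weight R a (shift b) (j ∷ qs) else 0#)
                                    (hasParts-shift k j qs))

  -- P^{[k]}_{j,0} = 0: the empty partition has no first part.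
  P-empty : ∀ b k j → P R a b k j 0 ≈ 0#
  P-empty b k j = +-identityˡ 0#

  -- P^{[k]}_{0,n+1} = 0: partitions have positive parts.
  P-firstZero : ∀ b k n → P R a b k 0 (suc n) ≈ 0#
  P-firstZero b k n = trans (P-head b k 0 n) (sumOver-zero (allLists n 1) (λ {qs} _ → term-zeroPart b k 0 qs))

  -- P^{[0]}_{j,1} = 1 for j > 0: the only partition is (j), of weight 1.
  P-singlePart : ∀ b j → P R a b 0 (suc j) 1 ≈ 1#
  P-singlePart b j = trans (P-head b 0 (suc j) 0) (+-identityʳ 1#)

  -- P^{[k]}_{j,1} = 0 for k ≥ 1: the partition (j) has no part j - 1.
  P-singlePart-constrained : ∀ b k j → P R a b (suc k) (suc j) 1 ≈ 0#
  P-singlePart-constrained b k j = trans (P-head b (suc k) (suc j) 0) (trans (+-congʳ excluded) (+-identityˡ 0#))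
    where
    excluded : term b (suc k) (suc j) [ suc j ] ≈ 0#
    excluded = if-false (weight R a b [ suc j ])
      (≡.trans (cong (isPartition [ suc j ] ∧_) (hasParts-dropTop (suc k) (suc j) [])) (∧-zeroʳ (isPartition [ suc j ])))

  recurrence-constrained : ∀ b k j n →
    P R a b (suc k) (suc j) (suc (suc n))
      ≈ (a (suc j) + b 1) * Pbar R a b (suc k) (suc j) (suc n) + Pbar R a b k j (suc n)
  recurrence-constrained b k j n = begin
    P R a b (suc k) (suc j) (suc (suc n))                     ≈⟨ P-split b (suc k) (suc j) n (s≤s z≤n) ⟩
    X + sumOver (upTo (suc j)) (tails b (suc k) (suc j) n)     ≈⟨ +-congˡ (sumOver-upTo-last j _) ⟩
    X + (sumOver (upTo j) (tails b (suc k) (suc j) n) + tails b (suc k) (suc j) n j)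
      ≈⟨ +-congˡ (+-cong (sumOver-zero (upTo j) (λ y∈ → tails-below b k j n _ (∈-upTo⁻ y∈))) (tails-top b k j n)) ⟩
    X + (0# + Pbar R a b k j (suc n))                         ≈⟨ +-congˡ (+-identityˡ _) ⟩
    X + Pbar R a b k j (suc n)                                ∎
    where
    X : Carrier
    X = (a (suc j) + b 1) * Pbar R a b (suc k) (suc j) (suc n)

  recurrence-unconstrained : ∀ b j n →
    P R a b 0 j (suc (suc n)) ≈ (a j + b 1) * Pbar R a b 0 j (suc n) + sumOver (upTo j) (λ y → Pbar R a b 0 y (suc n))
  recurrence-unconstrained b zero n = begin
    P R a b 0 0 (suc (suc n))                     ≈⟨ P-firstZero b 0 (suc n) ⟩
    0#                                            ≈⟨ zeroʳ _ ⟨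
    (a 0 + b 1) * 0#                              ≈⟨ *-congˡ (P-firstZero (shift b) 0 n) ⟨
    (a 0 + b 1) * Pbar R a b 0 0 (suc n)          ≈⟨ +-identityʳ _ ⟨
    (a 0 + b 1) * Pbar R a b 0 0 (suc n) + 0#     ∎
  recurrence-unconstrained b (suc j) n =
    trans (P-split b 0 (suc j) n (s≤s z≤n))
          (+-congˡ (sumOver-congᴹ (upTo (suc j)) (λ y∈ → tails-unconstrained b (suc j) n _ (<⇒≤ (∈-upTo⁻ y∈)))))

  -- The k = 0 recurrence of the theorem: the difference of the above at j + 1 and j.
  recurrence-difference : ∀ b j n →
    P R a b 0 (suc j) (suc (suc n))
      ≈ ((a (suc j) + b 1) * Pbar R a b 0 (suc j) (suc n) + Pbar R a b 0 j (suc n))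
        + (P R a b 0 j (suc (suc n)) - (a j + b 1) * Pbar R a b 0 j (suc n))
  recurrence-difference b j n = begin
    P R a b 0 (suc j) (suc (suc n))          ≈⟨ recurrence-unconstrained b (suc j) n ⟩
    X + sumOver (upTo (suc j)) P̄             ≈⟨ +-congˡ (sumOver-upTo-last j P̄) ⟩
    X + (sumOver (upTo j) P̄ + P̄ j)           ≈⟨ +-congˡ (+-comm _ _) ⟩
    X + (P̄ j + sumOver (upTo j) P̄)           ≈⟨ +-assoc X (P̄ j) _ ⟨
    (X + P̄ j) + sumOver (upTo j) P̄           ≈⟨ +-congˡ (x≈z//y _ _ _ (trans (+-comm _ _) (sym (recurrence-unconstrained b j n)))) ⟩
    (X + P̄ j) + (P R a b 0 j (suc (suc n)) - (a j + b 1) * P̄ j)  ∎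
    where
    open GroupProperties +-group using (x≈z//y)
    P̄ : ℕ → Carrier
    P̄ y = Pbar R a b 0 y (suc n)
    X : Carrier
    X = (a (suc j) + b 1) * P̄ (suc j)

  vanishing : ∀ i b k j → j ≤ k ⊎ i ≤ k → P R a b k j i ≈ 0#
  vanishing zero          b k       j       _        = P-empty b k j
  vanishing (suc n)       b k       zero    _        = P-firstZero b k n
  vanishing (suc n)       b zero    (suc j) (inj₁ ())
  vanishing (suc n)       b zero    (suc j) (inj₂ ())
  vanishing (suc zero)    b (suc k) (suc j) _        = P-singlePart-constrained b k j
  vanishing (suc (suc n)) b (suc k) (suc j) small    = begin
    P R a b (suc k) (suc j) (suc (suc n))
      ≈⟨ recurrence-constrained b k j n ⟩
    (a (suc j) + b 1) * Pbar R a b (suc k) (suc j) (suc n) + Pbar R a b k j (suc n)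
      ≈⟨ +-cong (*-congˡ (vanishing (suc n) (shift b) (suc k) (suc j) smallTop))
                (vanishing (suc n) (shift b) k j smallTail) ⟩
    (a (suc j) + b 1) * 0# + 0#  ≈⟨ +-identityʳ _ ⟩
    (a (suc j) + b 1) * 0#       ≈⟨ zeroʳ _ ⟩
    0#                           ∎
    where
    smallTop : suc j ≤ suc k ⊎ suc n ≤ suc k
    smallTop = ⊎-map id (≤-trans (n≤1+n (suc n))) small
    smallTail : j ≤ k ⊎ suc n ≤ k
    smallTail = ⊎-map ≤-pred ≤-pred small

lemma7 : ∀ {c ℓ} (R : CommutativeRing c ℓ) (a b : ℕ → CommutativeRing.Carrier R) →
    let open CommutativeRing R in
    (∀ k j i → (j ≤ k ⊎ i ≤ k) → P R a b k j i ≈ 0#)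
    × (∀ j → 0 < j → P R a b 0 j 1 ≈ 1#)
    × (∀ i j → 2 ≤ i → 1 ≤ j →
         P R a b 0 j i ≈
           ((a j + b 1) * Pbar R a b 0 j (i ∸ 1) + Pbar R a b 0 (j ∸ 1) (i ∸ 1))
           + (P R a b 0 (j ∸ 1) i - (a (j ∸ 1) + b 1) * Pbar R a b 0 (j ∸ 1) (i ∸ 1)))
    × (∀ k j i → 1 ≤ k → k < j → k < i →
         P R a b k j i ≈
           (a j + b 1) * Pbar R a b k j (i ∸ 1) + Pbar R a b (k ∸ 1) (j ∸ 1) (i ∸ 1))
lemma7 R a b = (λ k j i small → vanishing i b k j small) , singlePart , unconstrained , constrained
  where
  open CommutativeRing R
  open Recurrences R a
  singlePart : ∀ j → 0 < j → P R a b 0 j 1 ≈ 1#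
  singlePart (suc j) _ = P-singlePart b j
  unconstrained : ∀ i j → 2 ≤ i → 1 ≤ j →
    P R a b 0 j i ≈ ((a j + b 1) * Pbar R a b 0 j (i ∸ 1) + Pbar R a b 0 (j ∸ 1) (i ∸ 1))
                    + (P R a b 0 (j ∸ 1) i - (a (j ∸ 1) + b 1) * Pbar R a b 0 (j ∸ 1) (i ∸ 1))
  unconstrained (suc (suc n)) (suc j) _ _ = recurrence-difference b j n
  unconstrained (suc zero)    (suc j) (s≤s ()) _
  constrained : ∀ k j i → 1 ≤ k → k < j → k < i →
    P R a b k j i ≈ (a j + b 1) * Pbar R a b k j (i ∸ 1) + Pbar R a b (k ∸ 1) (j ∸ 1) (i ∸ 1)
  constrained (suc k) (suc j) (suc (suc n)) _ _ _ = recurrence-constrained b k j n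
  constrained (suc k) (suc j) (suc zero)    _ _ (s≤s ())
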